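{- Let $k\ge 2$ and $n=2k+1$. Every anchored Dyck word $w$ of length $n$ equals $f(\alpha)$ for some $k$-germ $\alpha$, where $f(\alpha)$ is the binary string associated with the $n$-nest $F(\alpha)$ (both defined in the context).
   Context: A $k$-germ ($k\ge 2$) is a string $\alpha=a_{k-1}a_{k-2}\cdots a_1$ of nonnegative integers with $a_{k-1}\in\{0,1\}$ and $0\le a_{i-1}\le a_i+1$ for $1<i<k$. For $\alpha\neq 0^{k-1}$ let $i(\alpha)$ be the index of the rightmost nonzero entry of $\alpha$, and let the parent $\beta$ of $\alpha$ be the $k$-germ equal to $\alpha$ except that $b_{i(\alpha)}=a_{i(\alpha)}-1$; this makes the $k$-germs the nodes of a tree $\mathcal T_k$ rooted at $0^{k-1}$. The $n$-nest $F(\alpha)$ is a string of length $n=2k+1$ over $\{0,1,\dots,k\}$ defined recursively along $\mathcal T_k$: $F(0^{k-1})=0\,1\,2\cdots(k-1)\,k\,k\,(k-1)\cdots 2\,1$; for $\alpha\ne 0^{k-1}$ with parent $\beta$ and $i=i(\alpha)$, write $F(\beta)=W^i|M|Z^i$ where $W^i$, $Z^i$ are the leftmost and rightmost substrings of length $i$, let $c$ be the leftmost entry of $M$, and split $M=X|Y$ where $Y$ starts at the (leftmost) entry equal to $c+1$ in $M$; then $F(\alpha)=W^i|Y|X|Z^i$ (an "$i$-nested castling"). In $F(\alpha)$ the entry $0$ appears once (at the start) and each $j\in[1,k]$ appears exactly twice. The binary string $f(\alpha)$ is obtained from $F(\alpha)$ by replacing the first appearance of each integer (including the initial $0$) by the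 bit $0$ and the second appearance of each $j\in[1,k]$ by the bit $1$. A Dyck word of length $2k$ is a binary string with $k$ ones in which every prefix has at least as many $0$'s as $1$'s; an anchored Dyck word of length $2k+1$ is a $0$ followed by a Dyck word of length $2k$. -}

module Defs where

open import Data.Nat using (ℕ; zero; suc; _+_; _*_; _∸_; _≤_; _≡ᵇ_)
open import Data.Bool using (Bool; true; false; if_then_else_)
open import Data.List using (List; []; _∷_; _++_; length; replicate; upTo; applyUpTo; reverse; take; filter)
open import Data.Bool.ListAction using (any)
open import Data.List.Relation.Unary.Linked using (Linked)
open import Data.List.Membership.Propositional using (_∉_)
open import Data.Unit using (⊤)
open import Data.Product using (_×_)
open import Relation.Binary.PropositionalEquality using (_≡_)
open import Relation.Nullary.Decidable using (does)
import Data.Nat.Properties as ℕP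

-- Strings are lists, written left to right.
-- A k-germ a_{k-1} a_{k-2} ... a_1 is the list (a_{k-1} ∷ a_{k-2} ∷ ... ∷ a_1 ∷ []).

HeadAtMost1 : List ℕ → Set
HeadAtMost1 []      = ⊤
HeadAtMost1 (x ∷ _) = x ≤ 1

StepOK : ℕ → ℕ → Set
StepOK x y = y ≤ suc x

IsGerm : ℕ → List ℕ → Set
IsGerm k α = (length α ≡ k ∸ 1) × HeadAtMost1 α × Linked StepOK α

rootNest : ℕ → List ℕ
rootNest k = upTo (suc k) ++ reverse (applyUpTo suc k)

-- Nest k α Φ : Φ = F(α), defined recursively along the tree T_k.
-- A non-root node α is written p ++ (suc a ∷ 0^m): its rightmost nonzero
-- entry has index i(α) = m + 1, and its parent is β = p ++ (a ∷ 0^m).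
-- The i-nested castling: F(β) = W | M | Z with |W| = |Z| = i, M = X | Y where
-- X starts with c (the leftmost entry of M), X does not contain c+1, and Y
-- starts with c+1 (so Y starts at the leftmost entry of M equal to c+1);
-- then F(α) = W | Y | X | Z.
data Nest (k : ℕ) : List ℕ → List ℕ → Set where
  root : Nest k (replicate (k ∸ 1) 0) (rootNest k)
  castle : ∀ (p : List ℕ) (a m c : ℕ) (W X′ Y′ Z : List ℕ) →
    Nest k (p ++ (a ∷ replicate m 0)) (W ++ ((c ∷ X′) ++ (suc c ∷ Y′)) ++ Z) →
    length W ≡ suc m →
    length Z ≡ suc m →
    suc c ∉ (c ∷ X′) →
    Nest k (p ++ (suc a ∷ replicate m 0)) (W ++ ((suc c ∷ Y′) ++ (c ∷ X′)) ++ Z)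

bitsFrom : List ℕ → List ℕ → List ℕ
bitsFrom seen []       = []
bitsFrom seen (x ∷ xs) =
  (if any (_≡ᵇ x) seen then 1 else 0) ∷ bitsFrom (x ∷ seen) xs

binaryOf : List ℕ → List ℕ
binaryOf Φ = bitsFrom [] Φ

count : ℕ → List ℕ → ℕ
count b w = length (filter (λ x → x ℕP.≟ b) w)

IsBit : ℕ → Set
IsBit x = x ≤ 1

IsDyck : ℕ → List ℕ → Set
IsDyck k d =
  (length d ≡ 2 * k) ×
  Data.List.Relation.Unary.All.All IsBit d ×
  (count 1 d ≡ k) ×
  (∀ j → count 1 (take j d) ≤ count 0 (take j d))
  where import Data.List.Relation.Unary.All

IsAnchoredDyck : ℕ → List ℕ → Set
IsAnchoredDyck k w = Data.Product.Σ (List ℕ) (λ d → (w ≡ 0 ∷ d) × IsDyck k d)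
  where import Data.Product

{-# OPTIONS --safe #-}
-- Read the Dyck word as a plane forest with k nodes (0 opens a node, 1 closes it).
-- Suppose the germ built so far ends in 0^j, and its nest is 0 1 ⋯ (j-1) | M+j | j ⋯ 2 1 with
-- M = 0 B_m ⋯ B_1 for pairwise disjoint blocks B_i avoiding 0 and starting with i, whose binary
-- words are those of the trees of a forest. Choosing the entry r at depth j+1 performs r castlings,
-- which rotate M into B_r ⋯ B_1 0 B_m ⋯ B_{r+1}. Seen at depth j, this is 0 followed by the blocks
-- B_r+1, …, B_1+1, (0 B_m ⋯ B_{r+1} 0)+1: the forest whose last r trees moved to the front and
-- whose first m-r trees are grafted under a new last root. Every forest with more than one node
-- arises in this way from a forest with one node fewer, and the single leaf gives F(0^{k-1}).

module Submission where

open import Defs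
open import Data.Nat using (ℕ; zero; suc; _+_; _*_; _∸_; _≤_; _≡ᵇ_; s≤s; s≤s⁻¹)
open import Data.Nat.Solver using (module +-*-Solver)
open import Data.Nat.Properties
open import Data.Bool using (true; false; if_then_else_; T; _∨_)
open import Data.Bool.Properties using (T-≡)
open import Data.Bool.ListAction using (any)
open import Data.Maybe using (Maybe; just; nothing)
open import Data.Maybe.Relation.Binary.Connected using (Connected; just; nothing-just)
open import Data.List
  using (List; []; _∷_; _++_; _∷ʳ_; [_]; length; replicate; upTo; applyUpTo; applyDownFrom;
         reverse; reverseAcc; take; map; concat; head; last; initLast; _∷ʳ′_)
open import Data.List.Properties
  using (map-++; ++-assoc; ++-identityʳ; length-++; length-map; length-upTo; length-applyDownFrom;
         upTo-∷ʳ; reverse-applyUpTo; concat-map; concat-++; ∷ʳ-++; map-cong; map-id; map-∘;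
         length-++-≤ʳ; ++-conicalˡ; ++-conicalʳ)
open import Data.List.Relation.Unary.All as All using (All; []; _∷_)
import Data.List.Relation.Unary.All.Properties as All
open import Data.List.Relation.Unary.Any using (here; there)
import Data.List.Relation.Unary.Any as Any
open import Data.List.Relation.Unary.Any.Properties using (any⁺; any⁻; reverseAcc⁺; reverseAcc⁻)
open import Data.List.Relation.Unary.AllPairs as AllPairs using (AllPairs; []; _∷_)
import Data.List.Relation.Unary.AllPairs.Properties as AllPairs
open import Data.List.Relation.Unary.Linked using (Linked; []; [-]; _∷_)
import Data.List.Relation.Unary.Linked.Properties as Linked
open import Data.List.Relation.Binary.Pointwise as Pointwise using (Pointwise; []; _∷_)
open import Data.List.Relation.Binary.Disjoint.Propositional using (Disjoint)
import Data.List.Relation.Binary.Disjoint.Propositional.Properties as Disjoint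
open import Data.List.Membership.Propositional using (_∈_; _∉_)
open import Data.List.Membership.Propositional.Properties using (∈-map⁻; ∈-++⁻)
open import Data.Product using (Σ; _×_; _,_; proj₁; ∃; ∃₂)
open import Data.Sum using (inj₁; inj₂)
open import Data.Empty using (⊥-elim)
open import Data.Unit using (tt)
open import Function using (_∘_; _⇔_; mk⇔; Equivalence)
open import Relation.Binary.PropositionalEquality
  using (_≡_; refl; sym; trans; cong; cong₂; subst; subst₂)
open Relation.Binary.PropositionalEquality.≡-Reasoning

T-injective : ∀ {a b} → T a ⇔ T b → a ≡ b
T-injective {false} {false} _ = refl
T-injective {true}  {true}  _ = refl
T-injective {true}  {false} a⇔b = ⊥-elim (Equivalence.to a⇔b tt)
T-injective {false} {true}  a⇔b = ⊥-elim (Equivalence.from a⇔b tt)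

any-≡ᵇ⇔∈ : ∀ {x} s → T (any (_≡ᵇ x) s) ⇔ x ∈ s
any-≡ᵇ⇔∈ {x} s = mk⇔
  (Any.map (λ {y} t → sym (≡ᵇ⇒≡ y x t)) ∘ any⁻ _ s)
  (any⁺ _ ∘ Any.map (λ {y} x≡y → ≡⇒≡ᵇ y x (sym x≡y)))

bitsFrom-cong : ∀ {s t} xs → (∀ {y} → y ∈ xs → y ∈ s ⇔ y ∈ t) →
  bitsFrom s xs ≡ bitsFrom t xs
bitsFrom-cong []       _ = refl
bitsFrom-cong {s} {t} (x ∷ xs) same =
  cong₂ (λ b bs → (if b then 1 else 0) ∷ bs) seen-same (bitsFrom-cong xs same-after-x)
  where
  open Equivalence
  seen-same : any (_≡ᵇ x) s ≡ any (_≡ᵇ x) t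
  seen-same = T-injective (mk⇔
    (from (any-≡ᵇ⇔∈ t) ∘ to (same (here refl)) ∘ to (any-≡ᵇ⇔∈ s))
    (from (any-≡ᵇ⇔∈ s) ∘ from (same (here refl)) ∘ to (any-≡ᵇ⇔∈ t)))
  same-after-x : ∀ {y} → y ∈ xs → y ∈ x ∷ s ⇔ y ∈ x ∷ t
  same-after-x y∈ = mk⇔
    (λ { (here e) → here e ; (there q) → there (to (same (there y∈)) q) })
    (λ { (here e) → here e ; (there q) → there (from (same (there y∈)) q) })

bitsFrom-fresh : ∀ {s} xs → Disjoint xs s → bitsFrom s xs ≡ binaryOf xs
bitsFrom-fresh xs disjoint =
  bitsFrom-cong xs (λ y∈ → mk⇔ (λ y∈s → ⊥-elim (disjoint (y∈ , y∈s))) λ ())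

bitsFrom-++ : ∀ s xs ys → bitsFrom s (xs ++ ys) ≡ bitsFrom s xs ++ bitsFrom (reverseAcc s xs) ys
bitsFrom-++ s []       ys = refl
bitsFrom-++ s (x ∷ xs) ys = cong (_ ∷_) (bitsFrom-++ (x ∷ s) xs ys)

bitsFrom-map-suc : ∀ s xs → bitsFrom (map suc s) (map suc xs) ≡ bitsFrom s xs
bitsFrom-map-suc s []       = refl
bitsFrom-map-suc s (x ∷ xs) =
  cong₂ (λ b bs → (if b then 1 else 0) ∷ bs) (any-suc s) (bitsFrom-map-suc (x ∷ s) xs)
  where
  any-suc : ∀ s → any (_≡ᵇ suc x) (map suc s) ≡ any (_≡ᵇ x) s
  any-suc []      = refl
  any-suc (y ∷ s) = cong (_ ∨_) (any-suc s)

-- Forests coded by blocks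

data Tree : Set where
  node : List Tree → Tree

treeWord   : Tree → List ℕ
forestWord : List Tree → List ℕ
treeWord (node ts) = 0 ∷ forestWord ts ++ [ 1 ]
forestWord []       = []
forestWord (t ∷ ts) = treeWord t ++ forestWord ts

treeSize : Tree → ℕ
size     : List Tree → ℕ
treeSize (node ts) = suc (size ts)
size []       = 0
size (t ∷ ts) = treeSize t + size ts

size-++ : ∀ f g → size (f ++ g) ≡ size f + size g
size-++ []      g = refl
size-++ (t ∷ f) g =
  trans (cong (treeSize t +_) (size-++ f g)) (sym (+-assoc (treeSize t) (size f) (size g)))

size-unroot : ∀ {n} E y → size (E ∷ʳ node y) ≡ suc n → size (y ++ E) ≡ n
size-unroot {n} E y size≡ = suc-injective (begin
    suc (size (y ++ E))
  ≡⟨ cong suc (size-++ y E) ⟩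
    suc (size y + size E)
  ≡⟨ cong suc (+-comm (size y) (size E)) ⟩
    suc (size E + size y)
  ≡⟨ sym (+-suc (size E) (size y)) ⟩
    size E + suc (size y)
  ≡⟨ cong (λ m → size E + suc m) (sym (+-identityʳ (size y))) ⟩
    size E + size [ node y ]
  ≡⟨ sym (size-++ E [ node y ]) ⟩
    size (E ∷ʳ node y)
  ≡⟨ size≡ ⟩
    suc n ∎)

size≡0⇒[] : ∀ f → size f ≡ 0 → f ≡ []
size≡0⇒[] []           _  = refl
size≡0⇒[] (node _ ∷ _) ()

single-leaf : ∀ E y → size (E ∷ʳ node y) ≡ 1 → y ≡ [] × E ≡ []
single-leaf E y size≡ = ++-conicalˡ y E no-trees , ++-conicalʳ y E no-trees
  where no-trees = size≡0⇒[] (y ++ E) (size-unroot E y size≡)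

Codes : List ℕ → Tree → Set
Codes B t = binaryOf B ≡ treeWord t

AllPairs-++⁻ : ∀ {A : Set} {R : A → A → Set} xs {ys} → AllPairs R (xs ++ ys) →
  AllPairs R xs × AllPairs R ys × All (λ y → All (λ x → R x y) xs) ys
AllPairs-++⁻ []       pairs = [] , pairs , All.universal (λ _ → []) _
AllPairs-++⁻ (x ∷ xs) (x~ ∷ pairs) with AllPairs-++⁻ xs pairs | All.++⁻ xs x~
... | left , right , across | x~xs , x~ys =
  x~xs ∷ left , right , All.zipWith (λ (x~y , xs~y) → x~y ∷ xs~y) (x~ys , across)

Disjoint-concat⁺ : {D : List ℕ} {Bs : List (List ℕ)} →
  All (λ B → Disjoint B D) Bs → Disjoint D (concat Bs)
Disjoint-concat⁺ Bs#D = Disjoint.concat⁺ʳ (All.map Disjoint.sym Bs#D)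

Disjoint-reverseAcc : {C : List ℕ} (s B : List ℕ) →
  Disjoint C s → Disjoint C B → Disjoint C (reverseAcc s B)
Disjoint-reverseAcc s B C#s C#B (v∈C , v∈) with reverseAcc⁻ s B v∈
... | inj₁ v∈s = C#s (v∈C , v∈s)
... | inj₂ v∈B = C#B (v∈C , v∈B)

bitsFrom-concat : ∀ {s Bs ts} → AllPairs Disjoint Bs → All (λ B → Disjoint B s) Bs →
  Pointwise Codes Bs ts → bitsFrom s (concat Bs) ≡ forestWord ts
bitsFrom-concat []              []            []               = refl
bitsFrom-concat {s} {B ∷ Bs} {t ∷ ts} (B~ ∷ pairs) (B#s ∷ Bs#s) (codes ∷ codess) = begin
    bitsFrom s (B ++ concat Bs)
  ≡⟨ bitsFrom-++ s B (concat Bs) ⟩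
    bitsFrom s B ++ bitsFrom (reverseAcc s B) (concat Bs)
  ≡⟨ cong₂ _++_ (trans (bitsFrom-fresh B B#s) codes) (bitsFrom-concat pairs Bs#seen codess) ⟩
    treeWord t ++ forestWord ts ∎
  where
  Bs#seen : All (λ C → Disjoint C (reverseAcc s B)) Bs
  Bs#seen = All.zipWith avoids-seen (B~ , Bs#s)
    where
    avoids-seen : ∀ {C} → Disjoint B C × Disjoint C s → Disjoint C (reverseAcc s B)
    avoids-seen (B#C , C#s) = Disjoint-reverseAcc s B C#s (Disjoint.sym B#C)

bitsFrom-blocks : ∀ {Bs ts} → AllPairs Disjoint Bs → All (0 ∉_) Bs →
  Pointwise Codes Bs ts → bitsFrom [ 0 ] (concat Bs) ≡ forestWord ts
bitsFrom-blocks pairs zero-free = bitsFrom-concat pairs (All.map avoids-0 zero-free)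
  where
  avoids-0 : ∀ {B} → 0 ∉ B → Disjoint B [ 0 ]
  avoids-0 0∉B (v∈B , here refl) = 0∉B v∈B

bitsFrom-seen : ∀ {x} s → x ∈ s → bitsFrom s [ x ] ≡ [ 1 ]
bitsFrom-seen {x} s x∈s
  rewrite Equivalence.to T-≡ (Equivalence.from (any-≡ᵇ⇔∈ {x} s) x∈s) = refl

wrap : List ℕ → List ℕ
wrap X = 0 ∷ X ∷ʳ 0

wrap-codes : ∀ {Bs ts} → AllPairs Disjoint Bs → All (0 ∉_) Bs →
  Pointwise Codes Bs ts → Codes (wrap (concat Bs)) (node ts)
wrap-codes {Bs} {ts} pairs zero-free codes = cong (0 ∷_) (begin
    bitsFrom [ 0 ] (X ++ [ 0 ])
  ≡⟨ bitsFrom-++ [ 0 ] X [ 0 ] ⟩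
    bitsFrom [ 0 ] X ++ bitsFrom (reverseAcc [ 0 ] X) [ 0 ]
  ≡⟨ cong₂ _++_ (bitsFrom-blocks pairs zero-free codes)
                (bitsFrom-seen (reverseAcc [ 0 ] X) (reverseAcc⁺ [ 0 ] X (inj₁ (here refl)))) ⟩
    forestWord ts ++ [ 1 ] ∎)
  where X = concat Bs

data HeadsCountDown : List (List ℕ) → Set where
  []  : HeadsCountDown []
  _∷_ : ∀ {B Bs} → head B ≡ just (suc (length Bs)) → HeadsCountDown Bs → HeadsCountDown (B ∷ Bs)

HeadsCountDown-++⁻ʳ : ∀ Pre {Suf} → HeadsCountDown (Pre ++ Suf) → HeadsCountDown Suf
HeadsCountDown-++⁻ʳ []        heads       = heads
HeadsCountDown-++⁻ʳ (_ ∷ Pre) (_ ∷ heads) = HeadsCountDown-++⁻ʳ Pre heads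

record WellFormed (Bs : List (List ℕ)) : Set where
  field
    heads     : HeadsCountDown Bs
    disjoint  : AllPairs Disjoint Bs
    zero-free : All (0 ∉_) Bs

GermPrefix : List ℕ → Set
GermPrefix α = HeadAtMost1 α × Linked StepOK α

MayFollow : Maybe ℕ → ℕ → Set
MayFollow nothing  r = r ≤ 1
MayFollow (just a) r = StepOK a r

MayFollow-≤ : ∀ m {r s} → s ≤ r → MayFollow m r → MayFollow m s
MayFollow-≤ nothing  s≤r r≤1   = ≤-trans s≤r r≤1
MayFollow-≤ (just a) s≤r r≤1+a = ≤-trans s≤r r≤1+a

last-∷ʳ : ∀ (α : List ℕ) r → last (α ∷ʳ r) ≡ just r
last-∷ʳ []           r = refl
last-∷ʳ (a ∷ [])     r = refl
last-∷ʳ (a ∷ b ∷ α)  r = last-∷ʳ (b ∷ α) r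

germPrefix-∷ʳ : ∀ α {r} → GermPrefix α → MayFollow (last α) r → GermPrefix (α ∷ʳ r)
germPrefix-∷ʳ []      _                  r≤1     = r≤1 , [-]
germPrefix-∷ʳ (a ∷ α) (a≤1 , linked) follows = a≤1 , Linked.++⁺ linked (connect _ follows) [-]
  where
  connect : ∀ m {r} → MayFollow m r → Connected StepOK m (just r)
  connect nothing  _       = nothing-just
  connect (just _) r≤1+a  = just r≤1+a

-- Castling inside a frame

frame : ℕ → List ℕ → List ℕ
frame i M = upTo i ++ map (_+ i) M ++ applyDownFrom suc i

∉-map-+ : ∀ {x} s xs → x ∉ xs → x + s ∉ map (_+ s) xs
∉-map-+ s xs x∉xs x+s∈ with ∈-map⁻ (_+ s) x+s∈
... | y , y∈xs , x+s≡y+s = x∉xs (subst (_∈ xs) (sym (+-cancelʳ-≡ s _ _ x+s≡y+s)) y∈xs)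

castling-framed : ∀ {k} p a m {Q D c} → head Q ≡ just c → head D ≡ just (suc c) → suc c ∉ Q →
  Nest k (p ++ a ∷ replicate m 0) (frame (suc m) (Q ++ D)) →
  Nest k (p ++ suc a ∷ replicate m 0) (frame (suc m) (D ++ Q))
castling-framed {k} p a m {c ∷ X} {_ ∷ Y} refl refl fresh nest =
  subst (Nest k _) (sym (framed (suc c ∷ Y) (c ∷ X)))
    (castle p a m (c + suc m) W (map shift X) (map shift Y) Z
      (subst (Nest k _) (framed (c ∷ X) (suc c ∷ Y)) nest)
      (length-upTo (suc m)) (length-applyDownFrom suc (suc m)) (∉-map-+ (suc m) (c ∷ X) fresh))
  where
  shift = _+ suc m
  W = upTo (suc m)
  Z = applyDownFrom suc (suc m)
  framed : ∀ A B → frame (suc m) (A ++ B) ≡ W ++ (map shift A ++ map shift B) ++ Z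
  framed A B = cong (λ M → W ++ M ++ Z) (map-++ shift A B)

head-∈ : ∀ {B : List ℕ} {c} → head B ≡ just c → c ∈ B
head-∈ {_ ∷ _} refl = here refl

head-countdown : ∀ {Bs} X → HeadsCountDown Bs → head (concat Bs ++ 0 ∷ X) ≡ just (length Bs)
head-countdown               X []         = refl
head-countdown {(_ ∷ _) ∷ _} X (refl ∷ _) = refl

-- The last block starts with some m and the rest with m - 1, so a castling moves it to the front.
rotate : ∀ {k} p j {Bs} Pre Suf → Bs ≡ Pre ++ Suf → HeadsCountDown Bs → AllPairs Disjoint Bs →
  Nest k (p ++ 0 ∷ replicate j 0) (frame (suc j) (0 ∷ concat Bs)) →
  Nest k (p ++ length Suf ∷ replicate j 0) (frame (suc j) (concat Suf ++ 0 ∷ concat Pre))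
rotate {k} p j Pre [] refl _ _ nest =
  subst (λ Bs → Nest k _ (frame (suc j) (0 ∷ concat Bs))) (++-identityʳ Pre) nest
rotate {k} p j Pre (D ∷ Suf) refl heads pairs nest
  with D-head ∷ Suf-heads ← HeadsCountDown-++⁻ʳ Pre heads
     | _ , (D#Suf ∷ _) , (Pre#D ∷ _) ← AllPairs-++⁻ Pre pairs =
  subst (λ M → Nest k _ (frame (suc j) M)) (sym (++-assoc D (concat Suf) (0 ∷ concat Pre)))
    (castling-framed p (length Suf) j (head-countdown (concat Pre) Suf-heads) D-head fresh
      (subst (λ M → Nest k _ (frame (suc j) M)) moved
        (rotate p j (Pre ∷ʳ D) Suf (sym (∷ʳ-++ Pre D Suf)) heads pairs nest)))
  where
  rest = concat Suf ++ 0 ∷ concat Pre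
  moved : concat Suf ++ 0 ∷ concat (Pre ∷ʳ D) ≡ rest ++ D
  moved = begin
      concat Suf ++ 0 ∷ concat (Pre ∷ʳ D)
    ≡⟨ cong (λ X → concat Suf ++ 0 ∷ X) (sym (concat-++ Pre [ D ])) ⟩
      concat Suf ++ 0 ∷ concat Pre ++ D ++ []
    ≡⟨ cong (λ X → concat Suf ++ 0 ∷ concat Pre ++ X) (++-identityʳ D) ⟩
      concat Suf ++ (0 ∷ concat Pre) ++ D
    ≡⟨ sym (++-assoc (concat Suf) (0 ∷ concat Pre) D) ⟩
      rest ++ D ∎
  fresh : suc (length Suf) ∉ rest
  fresh m∈rest with ∈-++⁻ (concat Suf) m∈rest
  ... | inj₁ m∈Suf         = Disjoint.concat⁺ʳ D#Suf (head-∈ D-head , m∈Suf)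
  ... | inj₂ (there m∈Pre) = Disjoint-concat⁺ Pre#D (head-∈ D-head , m∈Pre)

frame-suc : ∀ j M → frame (suc j) M ≡ frame j (0 ∷ map suc (M ∷ʳ 0))
frame-suc j M = begin
    upTo (suc j) ++ map (_+ suc j) M ++ suc j ∷ Z
  ≡⟨ cong (_++ map (_+ suc j) M ++ suc j ∷ Z) (sym (upTo-∷ʳ j)) ⟩
    upTo j ∷ʳ j ++ map (_+ suc j) M ++ suc j ∷ Z
  ≡⟨ ∷ʳ-++ (upTo j) j _ ⟩
    upTo j ++ j ∷ map (_+ suc j) M ++ [ suc j ] ++ Z
  ≡⟨ cong (λ L → upTo j ++ j ∷ L) (sym (++-assoc (map (_+ suc j) M) [ suc j ] Z)) ⟩
    upTo j ++ j ∷ (map (_+ suc j) M ++ [ suc j ]) ++ Z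
  ≡⟨ cong (λ L → upTo j ++ j ∷ L ++ Z) (sym (map-++ (_+ suc j) M [ 0 ])) ⟩
    upTo j ++ j ∷ map (_+ suc j) (M ∷ʳ 0) ++ Z
  ≡⟨ cong (λ L → upTo j ++ j ∷ L ++ Z) (shift-suc (M ∷ʳ 0)) ⟩
    upTo j ++ j ∷ map (_+ j) (map suc (M ∷ʳ 0)) ++ Z ∎
  where
  Z = applyDownFrom suc j
  shift-suc : ∀ L → map (_+ suc j) L ≡ map (_+ j) (map suc L)
  shift-suc L = trans (map-cong (λ x → +-suc x j) L) (map-∘ L)

lower : List (List ℕ) → List (List ℕ) → List (List ℕ)
lower Pre Suf = map (map suc) (Suf ∷ʳ wrap (concat Pre))

length-lower : ∀ Pre Suf → length (lower Pre Suf) ≡ suc (length Suf)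
length-lower Pre Suf = begin
    length (lower Pre Suf)
  ≡⟨ length-map (map suc) (Suf ∷ʳ wrap (concat Pre)) ⟩
    length (Suf ∷ʳ wrap (concat Pre))
  ≡⟨ length-++ Suf ⟩
    length Suf + 1
  ≡⟨ +-comm (length Suf) 1 ⟩
    suc (length Suf) ∎

frame-lower : ∀ j Pre Suf →
  frame (suc j) (concat Suf ++ 0 ∷ concat Pre) ≡ frame j (0 ∷ concat (lower Pre Suf))
frame-lower j Pre Suf = trans (frame-suc j M) (cong (λ L → frame j (0 ∷ L)) (sym concat-lower))
  where
  M = concat Suf ++ 0 ∷ concat Pre
  concat-lower : concat (lower Pre Suf) ≡ map suc (M ∷ʳ 0)
  concat-lower = begin
      concat (map (map suc) (Suf ∷ʳ wrap (concat Pre)))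
    ≡⟨ concat-map (Suf ∷ʳ wrap (concat Pre)) ⟩
      map suc (concat (Suf ∷ʳ wrap (concat Pre)))
    ≡⟨ cong (map suc) (sym (concat-++ Suf [ wrap (concat Pre) ])) ⟩
      map suc (concat Suf ++ wrap (concat Pre) ++ [])
    ≡⟨ cong (λ L → map suc (concat Suf ++ L)) (++-identityʳ (wrap (concat Pre))) ⟩
      map suc (concat Suf ++ wrap (concat Pre))
    ≡⟨ cong (map suc) (sym (++-assoc (concat Suf) (0 ∷ concat Pre) [ 0 ])) ⟩
      map suc (M ∷ʳ 0) ∎

Disjoint-map-suc : {xs ys : List ℕ} → Disjoint xs ys → Disjoint (map suc xs) (map suc ys)
Disjoint-map-suc {ys = ys} xs#ys (v∈xs , v∈ys) with ∈-map⁻ suc v∈xs | ∈-map⁻ suc v∈ys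
... | x , x∈xs , refl | y , y∈ys , x≡y =
  xs#ys (x∈xs , subst (_∈ ys) (sym (suc-injective x≡y)) y∈ys)

Disjoint-wrap : ∀ {B X} → 0 ∉ B → Disjoint B X → Disjoint B (wrap X)
Disjoint-wrap {X = X} 0∉B B#X (v∈B , here refl) = 0∉B v∈B
Disjoint-wrap {X = X} 0∉B B#X (v∈B , there v∈) with ∈-++⁻ X v∈
... | inj₁ v∈X        = B#X (v∈B , v∈X)
... | inj₂ (here refl) = 0∉B v∈B

zero-free-map-suc : ∀ Bs → All (0 ∉_) (map (map suc) Bs)
zero-free-map-suc []       = []
zero-free-map-suc (B ∷ Bs) = zero-free ∷ zero-free-map-suc Bs
  where
  zero-free : 0 ∉ map suc B
  zero-free 0∈ with ∈-map⁻ suc 0∈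
  ... | _ , _ , ()

heads-lower : ∀ Pre {Suf} → HeadsCountDown Suf → HeadsCountDown (lower Pre Suf)
heads-lower Pre []                         = refl ∷ []
heads-lower Pre {(_ ∷ _) ∷ Suf} (refl ∷ heads) =
  cong (λ n → just (suc n)) (sym (length-lower Pre Suf)) ∷ heads-lower Pre heads

wellFormed-lower : ∀ Pre Suf → WellFormed (Pre ++ Suf) → WellFormed (lower Pre Suf)
wellFormed-lower Pre Suf wf with AllPairs-++⁻ Pre (WellFormed.disjoint wf)
... | _ , Suf-pairs , Pre#Suf = record
  { heads     = heads-lower Pre (HeadsCountDown-++⁻ʳ Pre (WellFormed.heads wf))
  ; disjoint  = AllPairs.map⁺ (AllPairs.map Disjoint-map-suc
      (AllPairs.++⁺ Suf-pairs ([] ∷ []) (All.zipWith avoids-wrap (Suf-zero-free , Pre#Suf))))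
  ; zero-free = zero-free-map-suc (Suf ∷ʳ wrap (concat Pre))
  }
  where
  Suf-zero-free = All.++⁻ʳ Pre (WellFormed.zero-free wf)
  avoids-wrap : ∀ {B} → 0 ∉ B × All (λ P → Disjoint P B) Pre →
    All (Disjoint B) [ wrap (concat Pre) ]
  avoids-wrap (0∉B , Pre#B) = Disjoint-wrap 0∉B (Disjoint-concat⁺ Pre#B) ∷ []

codes-map-suc : ∀ {Bs ts} → Pointwise Codes Bs ts → Pointwise Codes (map (map suc) Bs) ts
codes-map-suc []                       = []
codes-map-suc {B ∷ _} (codes ∷ codess) = trans (bitsFrom-map-suc [] B) codes ∷ codes-map-suc codess

codes-lower : ∀ {Pre Suf y E} → WellFormed (Pre ++ Suf) →
  Pointwise Codes Pre y → Pointwise Codes Suf E → Pointwise Codes (lower Pre Suf) (E ∷ʳ node y)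
codes-lower {Pre} wf Pre-codes Suf-codes = codes-map-suc (Pointwise.++⁺ Suf-codes
  (wrap-codes (proj₁ (AllPairs-++⁻ Pre (WellFormed.disjoint wf)))
              (All.++⁻ˡ Pre (WellFormed.zero-free wf)) Pre-codes ∷ []))

-- Building the germ level by level

record Stage (k j : ℕ) (f : List Tree) : Set where
  field
    prefix        : List ℕ
    blocks        : List (List ℕ)
    length-prefix : length prefix + j ≡ k ∸ 1
    germPrefix    : GermPrefix prefix
    extensible    : MayFollow (last prefix) (length blocks)
    nest          : Nest k (prefix ++ replicate j 0) (frame j (0 ∷ concat blocks))
    codes         : Pointwise Codes blocks f
    wellFormed    : WellFormed blocks

rootNest-frame : ∀ k → rootNest k ≡ frame k [ 0 ]
rootNest-frame k = begin
    upTo (suc k) ++ reverse (applyUpTo suc k)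
  ≡⟨ cong₂ _++_ (sym (upTo-∷ʳ k)) (reverse-applyUpTo suc k) ⟩
    upTo k ∷ʳ k ++ applyDownFrom suc k
  ≡⟨ ∷ʳ-++ (upTo k) k (applyDownFrom suc k) ⟩
    frame k [ 0 ] ∎

leaf-stage : ∀ j → Stage (suc j) j [ node [] ]
leaf-stage j = record
  { prefix        = []
  ; blocks        = [ 1 ∷ 1 ∷ [] ]
  ; length-prefix = refl
  ; germPrefix    = tt , []
  ; extensible    = ≤-refl
  ; nest          = subst (Nest (suc j) (replicate j 0))
                      (trans (rootNest-frame (suc j)) (frame-suc j [ 0 ])) root
  ; codes         = refl ∷ []
  ; wellFormed    = record
    { heads     = refl ∷ []
    ; disjoint  = [] ∷ []
    ; zero-free = (λ { (here ()) ; (there (here ())) ; (there (there ())) }) ∷ []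
    }
  }

Pointwise-++-split : ∀ {A B : Set} {R : A → B → Set} ys {zs xs} → Pointwise R xs (ys ++ zs) →
  ∃₂ λ ws vs → xs ≡ ws ++ vs × Pointwise R ws ys × Pointwise R vs zs
Pointwise-++-split []       rel = [] , _ , refl , [] , rel
Pointwise-++-split (y ∷ ys) (r ∷ rel) with Pointwise-++-split ys rel
... | ws , vs , refl , left , right = _ ∷ ws , vs , refl , r ∷ left , right

step : ∀ {k j y E} → Stage k (suc j) (y ++ E) → Stage k j (E ∷ʳ node y)
step {k} {j} {y} record { prefix = p ; length-prefix = length-p ; germPrefix = germ-p
                        ; extensible = extensible ; nest = nest ; codes = codes ; wellFormed = wf }
  with Pre , Suf , refl , Pre-codes , Suf-codes ← Pointwise-++-split y codes = record
  { prefix        = p ∷ʳ length Suf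
  ; blocks        = lower Pre Suf
  ; length-prefix = trans (cong (_+ j) (length-++ p)) (trans (+-assoc (length p) 1 j) length-p)
  ; germPrefix    = germPrefix-∷ʳ p germ-p (MayFollow-≤ (last p) (length-++-≤ʳ Suf {Pre}) extensible)
  ; extensible    = subst₂ MayFollow (sym (last-∷ʳ p (length Suf))) (sym (length-lower Pre Suf)) ≤-refl
  ; nest          = subst₂ (Nest k) (sym (∷ʳ-++ p (length Suf) (replicate j 0))) (frame-lower j Pre Suf)
                      (rotate p j Pre Suf refl (WellFormed.heads wf) (WellFormed.disjoint wf) nest)
  ; codes         = codes-lower wf Pre-codes Suf-codes
  ; wellFormed    = wellFormed-lower Pre Suf wf
  }

stage : ∀ k n j f → size f ≡ suc n → suc n + j ≡ k → Stage k j f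
stage k n j f size≡ k≡ with initLast f
stage k n       j .[]              ()    _  | []
stage k zero    j .(E ∷ʳ node y) size≡ refl | E ∷ʳ′ node y
  with refl , refl ← single-leaf E y size≡ = leaf-stage j
stage k (suc n) j .(E ∷ʳ node y) size≡ k≡   | E ∷ʳ′ node y =
  step (stage k n (suc j) (y ++ E) (size-unroot E y size≡) (trans (+-suc (suc n) j) k≡))

-- Dyck words as forests

data DyckPath : ℕ → List ℕ → Set where
  []   : DyckPath 0 []
  up   : ∀ {h d} → DyckPath (suc h) d → DyckPath h (0 ∷ d)
  down : ∀ {h d} → DyckPath h d → DyckPath (suc h) (1 ∷ d)

dyckPath : ∀ h d → All IsBit d → (∀ j → count 1 (take j d) ≤ h + count 0 (take j d)) →
  count 1 d ≡ h + count 0 d → DyckPath h d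
dyckPath h []      _ _ ones≡ rewrite +-identityʳ h | sym ones≡ = []
dyckPath h (0 ∷ d) (_ ∷ bits) prefix ones≡ =
  up (dyckPath (suc h) d bits (λ j → subst (count 1 (take j d) ≤_) (+-suc h _) (prefix (suc j)))
       (trans ones≡ (+-suc h _)))
dyckPath zero    (1 ∷ d) _ prefix _ with () ← prefix 1
dyckPath (suc h) (1 ∷ d) (_ ∷ bits) prefix ones≡ =
  down (dyckPath h d bits (λ j → s≤s⁻¹ (prefix (suc j))) (suc-injective ones≡))
dyckPath h (suc (suc _) ∷ d) (s≤s () ∷ _) _ _

count-bits : ∀ d → All IsBit d → count 0 d + count 1 d ≡ length d
count-bits []            []         = refl
count-bits (0 ∷ d)       (_ ∷ bits) = cong suc (count-bits d bits)
count-bits (1 ∷ d)       (_ ∷ bits) = trans (+-suc (count 0 d) (count 1 d)) (cong suc (count-bits d bits))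
count-bits (suc (suc _) ∷ _) (s≤s () ∷ _)

closing : List (List Tree) → List ℕ
closing []       = []
closing (g ∷ gs) = 1 ∷ forestWord g ++ closing gs

-- Cut a Dyck path from height h at its last visits to the heights h - 1, …, 0.
decompose : ∀ {h d} → DyckPath h d →
  ∃₂ λ f gs → length gs ≡ h × d ≡ forestWord f ++ closing gs
decompose []       = [] , [] , refl , refl
decompose (down path) with decompose path
... | f , gs , refl , refl = [] , f ∷ gs , refl , refl
decompose (up path) with decompose path
... | f , g ∷ gs , refl , refl = node f ∷ g , gs , refl , sym (begin
    ((0 ∷ forestWord f ++ [ 1 ]) ++ forestWord g) ++ closing gs
  ≡⟨ ++-assoc (0 ∷ forestWord f ++ [ 1 ]) (forestWord g) (closing gs) ⟩
    0 ∷ (forestWord f ++ [ 1 ]) ++ forestWord g ++ closing gs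
  ≡⟨ cong (0 ∷_) (++-assoc (forestWord f) [ 1 ] (forestWord g ++ closing gs)) ⟩
    0 ∷ forestWord f ++ 1 ∷ forestWord g ++ closing gs ∎)

length-forestWord : ∀ f → length (forestWord f) ≡ 2 * size f
length-forestWord []             = refl
length-forestWord (node ts ∷ f) = begin
    length ((0 ∷ forestWord ts ++ [ 1 ]) ++ forestWord f)
  ≡⟨ length-++ (0 ∷ forestWord ts ++ [ 1 ]) ⟩
    suc (length (forestWord ts ++ [ 1 ])) + length (forestWord f)
  ≡⟨ cong (λ n → suc n + length (forestWord f)) (length-++ (forestWord ts)) ⟩
    suc (length (forestWord ts) + 1) + length (forestWord f)
  ≡⟨ cong₂ (λ a b → suc (a + 1) + b) (length-forestWord ts) (length-forestWord f) ⟩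
    suc (2 * size ts + 1) + 2 * size f
  ≡⟨ solve 2 (λ a b → (con 1 :+ (con 2 :* a :+ con 1)) :+ con 2 :* b := con 2 :* (con 1 :+ a :+ b))
       refl (size ts) (size f) ⟩
    2 * (suc (size ts) + size f) ∎
  where open +-*-Solver

dyck-forest : ∀ {k d} → IsDyck k d → ∃ λ f → d ≡ forestWord f × size f ≡ k
dyck-forest {k} {d} (length≡ , bits , ones≡ , prefix)
  with decompose (dyckPath 0 d bits prefix (trans ones≡ (sym zeros≡)))
  where
  zeros≡ : count 0 d ≡ k
  zeros≡ = +-cancelʳ-≡ k (count 0 d) k (begin
      count 0 d + k          ≡⟨ cong (count 0 d +_) (sym ones≡) ⟩
      count 0 d + count 1 d  ≡⟨ count-bits d bits ⟩
      length d               ≡⟨ length≡ ⟩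
      k + (k + 0)            ≡⟨ cong (k +_) (+-identityʳ k) ⟩
      k + k                  ∎)
... | f , [] , refl , d≡ = f , d≡f ,
  *-cancelˡ-≡ (size f) k 2 (trans (sym (length-forestWord f)) (trans (cong length (sym d≡f)) length≡))
  where d≡f = trans d≡ (++-identityʳ _)

frame-zero : ∀ M → frame 0 M ≡ M
frame-zero M = trans (++-identityʳ (map (_+ 0) M)) (trans (map-cong +-identityʳ M) (map-id M))

theorem3 : (k : ℕ) → 2 ≤ k → (w : List ℕ) → IsAnchoredDyck k w →
    Σ (List ℕ) (λ α → IsGerm k α × Σ (List ℕ) (λ Φ → Nest k α Φ × binaryOf Φ ≡ w))
theorem3 k (s≤s (s≤s {n = k′} _)) w (d , refl , dyck) with dyck-forest dyck
... | f , refl , size≡k =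
  prefix ++ [] , germ , frame 0 (0 ∷ concat blocks) , nest , cong (0 ∷_) bits
  where
  open Stage (stage k (suc k′) 0 f size≡k (+-identityʳ k))
  germ : IsGerm k (prefix ++ [])
  germ = subst (IsGerm k) (sym (++-identityʳ prefix))
    (trans (sym (+-identityʳ (length prefix))) length-prefix , germPrefix)
  bits : bitsFrom [ 0 ] (map (_+ 0) (concat blocks) ++ []) ≡ forestWord f
  bits = trans (cong (bitsFrom [ 0 ]) (frame-zero (concat blocks)))
    (bitsFrom-blocks (WellFormed.disjoint wellFormed) (WellFormed.zero-free wellFormed) codes)
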